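{- Let $n$ be a positive integer with $100 \nmid n$. Then $\mathrm{rbln}(n^n) = \mathrm{rbln}\big((n+100)^{n+100}\big)$.
   Context: For a positive integer $m$ written in base $10$, $\mathrm{rbln}(m)$ is defined as follows: if $m$ has exactly one non-zero decimal digit, then $\mathrm{rbln}(m)=0$; if $m$ has at least two non-zero decimal digits, then $\mathrm{rbln}(m)$ is the decimal digit immediately to the left of the last (rightmost) non-zero digit of $m$ (this digit may itself be $0$). For example, $\mathrm{rbln}(1000)=0$ and $\mathrm{rbln}(10504200)=4$. -}

module Defs where

open import Data.Nat using (ℕ; zero; suc; _+_; _*_; _^_; _<ᵇ_)
open import Data.Nat.DivMod using (_/_; _%_)
open import Data.Bool using (if_then_else_)
open import Data.Nat using (_≡ᵇ_)

-- Remove trailing decimal zeros, using a fuel argument (fuel ≥ number of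
-- trailing zeros suffices; we use the number itself as fuel).
stripZerosAux : ℕ → ℕ → ℕ
stripZerosAux zero    m = m
stripZerosAux (suc f) zero = zero
stripZerosAux (suc f) m@(suc _) =
  if (m % 10) ≡ᵇ 0 then stripZerosAux f (m / 10) else m

stripZeros : ℕ → ℕ
stripZeros m = stripZerosAux m m

-- rbln m: if m has exactly one nonzero digit (stripped value < 10) then 0,
-- otherwise the decimal digit immediately left of the last nonzero digit.
rbln : ℕ → ℕ
rbln m = let s = stripZeros m in
  if s <ᵇ 10 then 0 else (s / 10) % 10

{-# OPTIONS --safe #-}

-- Writing m = s * 10^k with 10 ∤ s, rbln m is the tens digit of s, i.e. (s mod 100) div 10.
-- If 10 ∤ n, then s = n^n on the left and s = (n+100)^(n+100) on the right, and these agree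
-- mod 100 because x^(k+100) ≡ x^k (mod 100) for every x once k ≥ 2 (modulo 4 and modulo 25,
-- x^2 is either 0 or a unit whose order divides 20).  If n = 10u with 10 ∤ u, the two sides
-- have s = u^n and s = (u+10)^(n+100); these agree mod 100 since (u+10)^10 ≡ u^10 (mod 100)
-- and the exponent shift by 100 is again invisible.

module Submission where

open import Defs
open import Data.Nat using (ℕ; suc; _+_; _^_; _<_)
open import Data.Nat.Divisibility using (_∣_)
open import Relation.Nullary using (¬_)
open import Relation.Binary.PropositionalEquality using (_≡_)

open import Data.Nat using (zero; _*_; _≤_; _<ᵇ_; z≤n; s≤s; NonZero; ≢-nonZero; >-nonZero)
open import Data.Nat.Properties
open import Data.Nat.DivMod
open import Data.Nat.Divisibility
  using (_∤_; divides; _∣?_; ∣-trans; m%n≡0⇒n∣m; ∣m+n∣m⇒∣n; *-monoˡ-∣; ∣⇒≤)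
open import Data.Nat.Coprimality using (Coprime; coprime-divisor; coprime?)
open import Data.Nat.Primality using (Prime; prime?; prime[2]; euclidsLemma)
open import Data.Bool using (true; false; T)
open import Data.Sum using (inj₁; inj₂)
open import Data.Unit using (tt)
open import Relation.Nullary using (yes; no; contradiction)
open import Relation.Nullary.Decidable using (from-yes)
open import Relation.Binary.PropositionalEquality using (refl; sym; trans; cong; subst; module ≡-Reasoning)
open import Algebra.Properties.CommutativeSemigroup *-commutativeSemigroup using (interchange; x∙yz≈xz∙y)

open ≡-Reasoning

%-distribˡ-^ : ∀ m n d .{{_ : NonZero d}} → m ^ n % d ≡ (m % d) ^ n % d
%-distribˡ-^ m zero    d = refl
%-distribˡ-^ m (suc n) d = begin
  m * m ^ n % d                           ≡⟨ %-distribˡ-* m (m ^ n) d ⟩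
  (m % d) * (m ^ n % d) % d               ≡⟨ cong (λ x → (x * (m ^ n % d)) % d) (sym (m%n%n≡m%n m d)) ⟩
  (m % d % d) * (m ^ n % d) % d           ≡⟨ cong (λ x → (m % d % d * x) % d) (%-distribˡ-^ m n d) ⟩
  (m % d % d) * ((m % d) ^ n % d) % d     ≡⟨ sym (%-distribˡ-* (m % d) ((m % d) ^ n) d) ⟩
  (m % d) * (m % d) ^ n % d               ∎

^-cong-% : ∀ {a b} n d .{{_ : NonZero d}} → a % d ≡ b % d → a ^ n % d ≡ b ^ n % d
^-cong-% {a} {b} n d a≡b = begin
  a ^ n % d          ≡⟨ %-distribˡ-^ a n d ⟩
  (a % d) ^ n % d    ≡⟨ cong (λ x → x ^ n % d) a≡b ⟩
  (b % d) ^ n % d    ≡⟨ sym (%-distribˡ-^ b n d) ⟩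
  b ^ n % d          ∎

^-distribʳ-* : ∀ m n o → (m * n) ^ o ≡ m ^ o * n ^ o
^-distribʳ-* m n zero    = refl
^-distribʳ-* m n (suc o) = begin
  m * n * (m * n) ^ o        ≡⟨ cong (m * n *_) (^-distribʳ-* m n o) ⟩
  m * n * (m ^ o * n ^ o)    ≡⟨ interchange m n (m ^ o) (n ^ o) ⟩
  m * m ^ o * (n * n ^ o)    ∎

n<m^n : ∀ m n → 1 < m → n < m ^ n
n<m^n m         zero    _   = s≤s z≤n
n<m^n m@(suc _) (suc n) 1<m = ≤-<-trans (n<m^n m n 1<m) m^n<m*m^n
  where
  m^n<m*m^n : m ^ n < m * m ^ n
  m^n<m*m^n = subst (m ^ n <_) (*-comm (m ^ n) m) (m<m*n (m ^ n) m {{m^n≢0 m n}} 1<m)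

x^102%100≡x^2%100 : ∀ x → x ^ 102 % 100 ≡ x ^ 2 % 100
x^102%100≡x^2%100 x = begin
  x ^ 102 % 100          ≡⟨ %-distribˡ-^ x 102 100 ⟩
  (x % 100) ^ 102 % 100  ≡⟨ on-residues (m%n<n x 100) ⟩
  (x % 100) ^ 2 % 100    ≡⟨ sym (%-distribˡ-^ x 2 100) ⟩
  x ^ 2 % 100            ∎
  where
  on-residues : ∀ {r} → r < 100 → r ^ 102 % 100 ≡ r ^ 2 % 100
  on-residues = from-yes (allUpTo? (λ r → r ^ 102 % 100 ≟ r ^ 2 % 100) 100)

x^[k+100]%100≡x^k%100 : ∀ x k → 2 ≤ k → x ^ (k + 100) % 100 ≡ x ^ k % 100
x^[k+100]%100≡x^k%100 x k@(suc (suc j)) (s≤s (s≤s _)) = begin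
  x ^ (k + 100) % 100              ≡⟨ cong (λ e → x ^ e % 100) (+-comm k 100) ⟩
  x ^ (102 + j) % 100              ≡⟨ cong (_% 100) (^-distribˡ-+-* x 102 j) ⟩
  x ^ 102 * x ^ j % 100            ≡⟨ %-distribˡ-* (x ^ 102) (x ^ j) 100 ⟩
  (x ^ 102 % 100) * (x ^ j % 100) % 100
    ≡⟨ cong (λ y → y * (x ^ j % 100) % 100) (x^102%100≡x^2%100 x) ⟩
  (x ^ 2 % 100) * (x ^ j % 100) % 100 ≡⟨ sym (%-distribˡ-* (x ^ 2) (x ^ j) 100) ⟩
  x ^ 2 * x ^ j % 100              ≡⟨ cong (_% 100) (sym (^-distribˡ-+-* x 2 j)) ⟩
  x ^ k % 100                      ∎

[x+10]^10%100≡x^10%100 : ∀ x → (x + 10) ^ 10 % 100 ≡ x ^ 10 % 100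
[x+10]^10%100≡x^10%100 x = begin
  (x + 10) ^ 10 % 100          ≡⟨ ^-cong-% {x + 10} {x % 100 + 10} 10 100 (%-distribˡ-+ x 10 100) ⟩
  (x % 100 + 10) ^ 10 % 100    ≡⟨ on-residues (m%n<n x 100) ⟩
  (x % 100) ^ 10 % 100         ≡⟨ sym (%-distribˡ-^ x 10 100) ⟩
  x ^ 10 % 100                 ∎
  where
  on-residues : ∀ {r} → r < 100 → (r + 10) ^ 10 % 100 ≡ r ^ 10 % 100
  on-residues = from-yes (allUpTo? (λ r → (r + 10) ^ 10 % 100 ≟ r ^ 10 % 100) 100)

[x+10]^[k*10]%100≡x^[k*10]%100 : ∀ x k → (x + 10) ^ (k * 10) % 100 ≡ x ^ (k * 10) % 100
[x+10]^[k*10]%100≡x^[k*10]%100 x k = begin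
  (x + 10) ^ (k * 10) % 100     ≡⟨ cong (_% 100) (sym (^10^k≡^[k*10] (x + 10))) ⟩
  ((x + 10) ^ 10) ^ k % 100     ≡⟨ ^-cong-% k 100 ([x+10]^10%100≡x^10%100 x) ⟩
  (x ^ 10) ^ k % 100            ≡⟨ cong (_% 100) (^10^k≡^[k*10] x) ⟩
  x ^ (k * 10) % 100            ∎
  where
  ^10^k≡^[k*10] : ∀ m → (m ^ 10) ^ k ≡ m ^ (k * 10)
  ^10^k≡^[k*10] m = trans (^-*-assoc m 10 k) (cong (m ^_) (*-comm 10 k))

[n+100]^[n+100]%100≡n^n%100 : ∀ n .{{_ : NonZero n}} → (n + 100) ^ (n + 100) % 100 ≡ n ^ n % 100
-- x^101 ≢ x (mod 100) in general (x = 2), so n = 1 is evaluated directly.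
[n+100]^[n+100]%100≡n^n%100 (suc zero)    = refl
[n+100]^[n+100]%100≡n^n%100 n@(suc (suc _)) = begin
  (n + 100) ^ (n + 100) % 100   ≡⟨ ^-cong-% {n + 100} {n} (n + 100) 100 ([m+n]%n≡m%n n 100) ⟩
  n ^ (n + 100) % 100           ≡⟨ x^[k+100]%100≡x^k%100 n n (s≤s (s≤s z≤n)) ⟩
  n ^ n % 100                   ∎

[u+10]^[[u+10]*10]%100≡u^[u*10]%100 : ∀ u .{{_ : NonZero u}} →
  (u + 10) ^ ((u + 10) * 10) % 100 ≡ u ^ (u * 10) % 100
[u+10]^[[u+10]*10]%100≡u^[u*10]%100 u = begin
  (u + 10) ^ ((u + 10) * 10) % 100  ≡⟨ [x+10]^[k*10]%100≡x^[k*10]%100 u (u + 10) ⟩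
  u ^ ((u + 10) * 10) % 100         ≡⟨ cong (λ e → u ^ e % 100) (*-distribʳ-+ 10 u 10) ⟩
  u ^ (u * 10 + 100) % 100          ≡⟨ x^[k+100]%100≡x^k%100 u (u * 10) 2≤u*10 ⟩
  u ^ (u * 10) % 100                ∎
  where
  2≤u*10 : 2 ≤ u * 10
  2≤u*10 = ≤-trans (s≤s (s≤s z≤n)) (m≤n*m 10 u)

∣m^[1+n]⇒∣m : ∀ {p} m n → Prime p → p ∣ m ^ suc n → p ∣ m
∣m^[1+n]⇒∣m m zero    _ p∣m^1 = subst (_ ∣_) (*-identityʳ m) p∣m^1
∣m^[1+n]⇒∣m m (suc n) p p∣m^[2+n] with euclidsLemma m (m ^ suc n) p p∣m^[2+n]
... | inj₁ p∣m       = p∣m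
... | inj₂ p∣m^[1+n] = ∣m^[1+n]⇒∣m m n p p∣m^[1+n]

coprime∧∣∧∣⇒*∣ : ∀ {m n o} → Coprime m n → m ∣ o → n ∣ o → m * n ∣ o
coprime∧∣∧∣⇒*∣ {m} {n} {o} m⊥n m∣o (divides q o≡q*n)
  with coprime-divisor m⊥n (subst (m ∣_) (trans o≡q*n (*-comm q n)) m∣o)
... | divides r q≡r*m = divides r (begin
  o            ≡⟨ o≡q*n ⟩
  q * n        ≡⟨ cong (_* n) q≡r*m ⟩
  r * m * n    ≡⟨ *-assoc r m n ⟩
  r * (m * n)  ∎)

∤m∧∣n⇒∤m+n : ∀ {d m n} → d ∤ m → d ∣ n → d ∤ m + n
∤m∧∣n⇒∤m+n {d} {m} {n} d∤m d∣n d∣m+n = d∤m (∣m+n∣m⇒∣n (subst (d ∣_) (+-comm m n) d∣m+n) d∣n)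

10∤⇒10∤^ : ∀ m n → 10 ∤ m → 10 ∤ m ^ n
10∤⇒10∤^ m zero    _    10∣1 with ∣⇒≤ 10∣1
... | s≤s ()
10∤⇒10∤^ m (suc n) 10∤m 10∣m^[1+n] = 10∤m (coprime∧∣∧∣⇒*∣ 2⊥5
  (∣m^[1+n]⇒∣m m n prime[2] (∣-trans (divides 5 refl) 10∣m^[1+n]))
  (∣m^[1+n]⇒∣m m n prime[5] (∣-trans (divides 2 refl) 10∣m^[1+n])))
  where
  2⊥5 : Coprime 2 5
  2⊥5 = from-yes (coprime? 2 5)
  prime[5] : Prime 5
  prime[5] = from-yes (prime? 5)

stripZerosAux-10∣ : ∀ f m .{{_ : NonZero m}} → m % 10 ≡ 0 →
  stripZerosAux (suc f) m ≡ stripZerosAux f (m / 10)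
stripZerosAux-10∣ f m@(suc _) m%10≡0 with m % 10 | m%10≡0
... | .0 | refl = refl

stripZerosAux-∤ : ∀ f s → 10 ∤ s → stripZerosAux f s ≡ s
stripZerosAux-∤ zero    s         _    = refl
stripZerosAux-∤ (suc f) zero      10∤0 = contradiction (divides 0 refl) 10∤0
stripZerosAux-∤ (suc f) s@(suc _) 10∤s with s % 10 in s%10≡r
... | zero  = contradiction (m%n≡0⇒n∣m s 10 s%10≡r) 10∤s
... | suc _ = refl

stripZerosAux-*10^ : ∀ f s k .{{_ : NonZero s}} → k ≤ f → 10 ∤ s →
  stripZerosAux f (s * 10 ^ k) ≡ s
stripZerosAux-*10^ f s zero _ 10∤s =
  trans (cong (stripZerosAux f) (*-identityʳ s)) (stripZerosAux-∤ f s 10∤s)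
stripZerosAux-*10^ (suc f) s (suc k) {{s≢0}} (s≤s k≤f) 10∤s = begin
  stripZerosAux (suc f) (s * (10 * 10 ^ k))  ≡⟨ cong (stripZerosAux (suc f)) (x∙yz≈xz∙y s 10 (10 ^ k)) ⟩
  stripZerosAux (suc f) (s * 10 ^ k * 10)
    ≡⟨ stripZerosAux-10∣ f (s * 10 ^ k * 10) {{s*10^[1+k]≢0}} (m*n%n≡0 (s * 10 ^ k) 10) ⟩
  stripZerosAux f (s * 10 ^ k * 10 / 10)     ≡⟨ cong (stripZerosAux f) (m*n/n≡m (s * 10 ^ k) 10) ⟩
  stripZerosAux f (s * 10 ^ k)               ≡⟨ stripZerosAux-*10^ f s k k≤f 10∤s ⟩
  s                                          ∎
  where
  s*10^[1+k]≢0 : NonZero (s * 10 ^ k * 10)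
  s*10^[1+k]≢0 = m*n≢0 (s * 10 ^ k) 10 {{m*n≢0 s (10 ^ k) {{s≢0}} {{m^n≢0 10 k}}}}

stripZeros-*10^ : ∀ s k → 10 ∤ s → stripZeros (s * 10 ^ k) ≡ s
stripZeros-*10^ s k 10∤s = stripZerosAux-*10^ (s * 10 ^ k) s k k≤s*10^k 10∤s
  where
  instance
    s≢0 : NonZero s
    s≢0 = ≢-nonZero λ { refl → 10∤s (divides 0 refl) }
  k≤s*10^k : k ≤ s * 10 ^ k
  k≤s*10^k = ≤-trans (<⇒≤ (n<m^n 10 k (s≤s (s≤s z≤n)))) (m≤n*m (10 ^ k) s)

rbln-stripZeros : ∀ m → rbln m ≡ stripZeros m % 100 / 10
rbln-stripZeros m with stripZeros m <ᵇ 10 in s<ᵇ10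
... | true  = sym (trans (cong (_/ 10) (m<n⇒m%n≡m (≤-trans s<10 (m≤m+n 10 90)))) (m<n⇒m/n≡0 s<10))
  where
  s<10 : stripZeros m < 10
  s<10 = <ᵇ⇒< (stripZeros m) 10 (subst T (sym s<ᵇ10) tt)
... | false = sym (m%[n*o]/o≡m/o%n (stripZeros m) 10 10)

rbln-*10^ : ∀ s k → 10 ∤ s → rbln (s * 10 ^ k) ≡ s % 100 / 10
rbln-*10^ s k 10∤s =
  trans (rbln-stripZeros (s * 10 ^ k)) (cong (λ t → t % 100 / 10) (stripZeros-*10^ s k 10∤s))

rbln-10∤ : ∀ s → 10 ∤ s → rbln s ≡ s % 100 / 10
rbln-10∤ s 10∤s = trans (cong rbln (sym (*-identityʳ s))) (rbln-*10^ s 0 10∤s)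

rbln-[*10]^ : ∀ s e → 10 ∤ s → rbln ((s * 10) ^ e) ≡ s ^ e % 100 / 10
rbln-[*10]^ s e 10∤s =
  trans (cong rbln (^-distribʳ-* s 10 e)) (rbln-*10^ (s ^ e) e (10∤⇒10∤^ s e 10∤s))

lemma2p4 : (n : ℕ) → 0 < n → ¬ (100 ∣ n) →
    rbln (n ^ n) ≡ rbln ((n + 100) ^ (n + 100))
lemma2p4 n 0<n 100∤n with 10 ∣? n
... | no 10∤n = begin
  rbln (n ^ n)                      ≡⟨ rbln-10∤ (n ^ n) (10∤⇒10∤^ n n 10∤n) ⟩
  n ^ n % 100 / 10                  ≡⟨ cong (_/ 10) (sym ([n+100]^[n+100]%100≡n^n%100 n {{>-nonZero 0<n}})) ⟩
  (n + 100) ^ (n + 100) % 100 / 10  ≡⟨ sym (rbln-10∤ _ (10∤⇒10∤^ (n + 100) (n + 100) 10∤n+100)) ⟩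
  rbln ((n + 100) ^ (n + 100))      ∎
  where
  10∤n+100 : 10 ∤ n + 100
  10∤n+100 = ∤m∧∣n⇒∤m+n 10∤n (divides 10 refl)
... | yes (divides u refl) = begin
  rbln ((u * 10) ^ (u * 10))                ≡⟨ rbln-[*10]^ u (u * 10) 10∤u ⟩
  u ^ (u * 10) % 100 / 10                   ≡⟨ cong (_/ 10) (sym ([u+10]^[[u+10]*10]%100≡u^[u*10]%100 u {{u≢0}})) ⟩
  (u + 10) ^ ((u + 10) * 10) % 100 / 10     ≡⟨ sym (rbln-[*10]^ (u + 10) ((u + 10) * 10) 10∤u+10) ⟩
  rbln (((u + 10) * 10) ^ ((u + 10) * 10))  ≡⟨ cong (λ m → rbln (m ^ m)) (*-distribʳ-+ 10 u 10) ⟩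
  rbln ((u * 10 + 100) ^ (u * 10 + 100))    ∎
  where
  u≢0 : NonZero u
  u≢0 = m*n≢0⇒m≢0 u {{>-nonZero 0<n}}
  10∤u : 10 ∤ u
  10∤u 10∣u = 100∤n (*-monoˡ-∣ 10 10∣u)
  10∤u+10 : 10 ∤ u + 10
  10∤u+10 = ∤m∧∣n⇒∤m+n 10∤u (divides 1 refl)
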